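{- Let $q\ge 2$ and $n\ge 2$, and let $S=(s_i)$ be a negative orientable sequence of order $n$ over $\mathbb{Z}_q$. Then the period of $S$ is at most \[ \begin{cases} \bigl(q^n - q^{\lfloor n/2\rfloor} - q^{\lfloor (n-1)/2\rfloor} + 1\bigr)/2 & \text{if $q$ is odd},\\ \bigl(q^n - 2q^{(n-1)/2}\bigr)/2 - 1 & \text{if $q$ is even and $n$ is odd},\\ \bigl(q^n - q^{n/2}\bigr)/2 - 1 & \text{if $q$ is even and $n$ is even}. \end{cases} \]
   Context: Sequences are periodic with entries in $\mathbb{Z}_q$. For a sequence $S=(s_i)$ write $\mathbf{s}_n(i)=(s_i,s_{i+1},\ldots,s_{i+n-1})$. For an $n$-tuple $\mathbf{u}=(u_0,\ldots,u_{n-1})$, its reverse is $\mathbf{u}^R=(u_{n-1},\ldots,u_0)$ and its negative is $-\mathbf{u}=(-u_0,\ldots,-u_{n-1})$. A periodic sequence $S$ of period $m$ is an $n$-window sequence if $\mathbf{s}_n(i)=\mathbf{s}_n(j)$ implies $i\equiv j \pmod m$. An $n$-window sequence $S$ is a negative orientable sequence of order $n$ if $\mathbf{s}_n(i)\neq -\mathbf{s}_n(j)^R$ for all $i,j$. -}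

module Defs where

open import Data.Nat using (ℕ; zero; suc; _+_; _*_; _∸_; _^_; _≤_; NonZero)
open import Data.Nat.DivMod using (_/_; _%_)

open import Data.Fin using (Fin; toℕ; fromℕ<; opposite)
open import Data.Nat.DivMod using (m%n<n)
open import Relation.Binary.PropositionalEquality using (_≡_)
open import Relation.Nullary using (¬_)
open import Data.Product using (_×_)

-- A periodic sequence of period m over ℤ_q, given by one period:
-- s i is the entry s_i for 0 ≤ i < m, and s_j = s (j mod m) in general.
-- ℤ_q is represented by Fin q (residues 0,…,q-1).

entry : {m q : ℕ} .{{_ : NonZero m}} → (Fin m → Fin q) → ℕ → Fin q
entry {m} s j = s (fromℕ< (m%n<n j m))

window : {m q : ℕ} .{{_ : NonZero m}} → (n : ℕ) → (Fin m → Fin q) → Fin m → (Fin n → Fin q)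
window n s i k = entry s (toℕ i + toℕ k)

negZ : {q : ℕ} .{{_ : NonZero q}} → Fin q → Fin q
negZ {q} x = fromℕ< (m%n<n (q ∸ toℕ x) q)

negT : {n q : ℕ} .{{_ : NonZero q}} → (Fin n → Fin q) → (Fin n → Fin q)
negT u k = negZ (u k)

rev : {n q : ℕ} → (Fin n → Fin q) → (Fin n → Fin q)
rev u k = u (opposite k)

-- n-window sequence: s_n(i) = s_n(j) implies i ≡ j (mod m)
-- (i, j range over one period, since windows are periodic in i)
IsWindowSeq : {m q : ℕ} .{{_ : NonZero m}} → (n : ℕ) → (Fin m → Fin q) → Set
IsWindowSeq n s = ∀ i j → (∀ k → window n s i k ≡ window n s j k) → i ≡ j

IsNOS : {m q : ℕ} .{{_ : NonZero m}} .{{_ : NonZero q}} → (n : ℕ) → (Fin m → Fin q) → Set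
IsNOS n s = IsWindowSeq n s ×
  (∀ i j → ¬ (∀ k → window n s i k ≡ rev (negT (window n s j)) k))


IsOdd : ℕ → Set
IsOdd k = k % 2 ≡ 1

IsEven : ℕ → Set
IsEven k = k % 2 ≡ 0

{-# OPTIONS --safe #-}
module Submission where

open import Defs
open import Data.Nat using (ℕ; zero; suc; _+_; _*_; _∸_; _^_; _≤_; _<_; s≤s; z≤n; NonZero; _<?_)
  renaming (_≟_ to _≟ℕ_)
open import Data.Nat.Properties
open import Data.Nat.DivMod
open import Data.Nat.Divisibility using (_∣_; divides; ∣-refl; ∣m⇒∣m*n; m∣m*n; m%n≡0⇒n∣m)
open import Data.Nat.Tactic.RingSolver using (solve-∀)
open import Data.Fin using (Fin; zero; suc; toℕ; fromℕ<; opposite; inject₁; inject≤; funToFin; finToFun;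
  combine; splitAt; join; punchIn)
open import Data.Fin.Properties using (toℕ-injective; toℕ-fromℕ<; fromℕ<-cong; toℕ<n; toℕ-inject₁; toℕ-inject≤;
  opposite-prop; opposite-involutive; funToFin-finToFin; finToFun-funToFin; injective⇒≤; join-splitAt;
  punchIn-injective; punchInᵢ≢i; any?)
  renaming (_≟_ to _≟ᶠ_)
open import Data.Fin.Permutation using (permutation)
open import Data.Vec.Functional using (Vector; _∷_; head; tail; init; last; removeAt; _++_)
open import Data.Vec.Functional.Properties using (∷-cong; ∷-injective; ≗-dec)
open import Data.Vec.Functional.Relation.Unary.All.Properties using (++⁺)
open import Data.Sum using (inj₁; inj₂; [_,_])
open import Data.Product using (∃; _×_; _,_; proj₁; proj₂)
open import Data.Empty using (⊥-elim)
open import Function using (_∘_)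
open import Function.Definitions using (Injective)
open import Relation.Binary using (Rel; Setoid; Symmetric; Tri; tri<; tri≈; tri>)
open import Relation.Binary.PropositionalEquality hiding ([_])
open import Relation.Nullary using (¬_; Dec; yes; no; ¬?; _×-dec_)
open import Relation.Nullary.Decidable using (dec-yes; dec-no)
open import Algebra.Properties.CommutativeMonoid.Sum +-0-commutativeMonoid
  using (sum; sum-permute; sum-cong-≗; ∑-distrib-+; sum-remove; sum-replicate-zero)

-- The tuples s_n(i) and -s_n(i)ᴿ are 2m distinct elements of ℤ_qⁿ, and none of them is a negative
-- palindrome (a tuple u with u = -uᴿ), since s_n(i) = -s_n(i)ᴿ is forbidden.  A negative palindrome
-- is determined by its first ⌊n/2⌋ entries and, for odd n, a self-negative middle entry (0, or also
-- q/2 when q is even), which gives q^⌊n/2⌋ (resp. 2q^⌊n/2⌋) further tuples.  More tuples missed by S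
-- come from an involution.  For a negative palindrome v of length n - 1, a window x ∷ v is followed
-- by a window whose negative reverse has the form x′ ∷ v; pairing such x with x′, and leaving every
-- other x alone, is an involution of ℤ_q whose fixed points x give tuples x ∷ v that are neither
-- windows nor negative reverses of windows.  The number of fixed points of an involution of ℤ_q is
-- congruent to q modulo 2: for odd q every nonzero v contributes such a tuple, and for even q the
-- vertex v = 0, for which 0 is fixed, contributes a nonzero one.

m*2≡m+m : ∀ m → m * 2 ≡ m + m
m*2≡m+m m = trans (*-comm m 2) (cong (m +_) (+-identityʳ m))

m≡m%2+[m/2+m/2] : ∀ m → m ≡ m % 2 + (m / 2 + m / 2)
m≡m%2+[m/2+m/2] m = trans (m≡m%n+[m/n]*n m 2) (cong (m % 2 +_) (m*2≡m+m (m / 2)))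

m/2+m/2≤m : ∀ m → m / 2 + m / 2 ≤ m
m/2+m/2≤m m = subst (m / 2 + m / 2 ≤_) (sym (m≡m%2+[m/2+m/2] m)) (m≤n+m _ (m % 2))

even⇒≡m/2+m/2 : ∀ {m} → IsEven m → m ≡ m / 2 + m / 2
even⇒≡m/2+m/2 {m} m-even = trans (m≡m%2+[m/2+m/2] m) (cong (_+ (m / 2 + m / 2)) m-even)

odd⇒≡1+m/2+m/2 : ∀ {m} → IsOdd m → m ≡ suc (m / 2 + m / 2)
odd⇒≡1+m/2+m/2 {m} m-odd = trans (m≡m%2+[m/2+m/2] m) (cong (_+ (m / 2 + m / 2)) m-odd)

odd⇒[m∸1]/2≡m/2 : ∀ {m} → IsOdd m → (m ∸ 1) / 2 ≡ m / 2
odd⇒[m∸1]/2≡m/2 {m} m-odd = begin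
  (m ∸ 1) / 2          ≡⟨ cong (λ t → (t ∸ 1) / 2) (odd⇒≡1+m/2+m/2 {m} m-odd) ⟩
  (m / 2 + m / 2) / 2  ≡⟨ cong (_/ 2) (m*2≡m+m (m / 2)) ⟨
  m / 2 * 2 / 2        ≡⟨ m*n/n≡m (m / 2) 2 ⟩
  m / 2                ∎
  where open ≡-Reasoning

even⇒2∣^ : ∀ {q k} → IsEven q → 1 ≤ k → 2 ∣ q ^ k
even⇒2∣^ {q} {suc k} q-even _ = ∣m⇒∣m*n (q ^ k) (m%n≡0⇒n∣m q 2 q-even)

%-cong-+ʳ : ∀ {a b} c d .{{_ : NonZero d}} → a % d ≡ b % d → (a + c) % d ≡ (b + c) % d
%-cong-+ʳ {a} {b} c d eq = begin
  (a + c) % d          ≡⟨ %-distribˡ-+ a c d ⟩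
  (a % d + c % d) % d  ≡⟨ cong (λ t → (t + c % d) % d) eq ⟩
  (b % d + c % d) % d  ≡⟨ %-distribˡ-+ b c d ⟨
  (b + c) % d          ∎
  where open ≡-Reasoning

%-cong-+ˡ : ∀ {a b} c d .{{_ : NonZero d}} → a % d ≡ b % d → (c + a) % d ≡ (c + b) % d
%-cong-+ˡ {a} {b} c d eq = subst₂ (λ x y → x % d ≡ y % d) (+-comm a c) (+-comm b c) (%-cong-+ʳ {a} {b} c d eq)

m+m≤n⇒m≤n/2 : ∀ {m n} → m + m ≤ n → m ≤ n / 2
m+m≤n⇒m≤n/2 {m} {n} le = subst (_≤ n / 2) (m*n/n≡m m 2) (/-monoˡ-≤ 2 (subst (_≤ n) (sym (m*2≡m+m m)) le))

m∸n≤m∸[1+n]+1 : ∀ m n → m ∸ n ≤ m ∸ suc n + 1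
m∸n≤m∸[1+n]+1 zero    zero    = z≤n
m∸n≤m∸[1+n]+1 zero    (suc n) = z≤n
m∸n≤m∸[1+n]+1 (suc m) zero    = ≤-reflexive (+-comm 1 m)
m∸n≤m∸[1+n]+1 (suc m) (suc n) = m∸n≤m∸[1+n]+1 m n

halve-odd : ∀ {m x y z} → 1 ≤ z → m + m + y + (z ∸ 1) ≤ x → m ≤ (x ∸ y ∸ z + 1) / 2
halve-odd {m} {x} {y} {suc z} _ le = m+m≤n⇒m≤n/2 (begin
  m + m              ≤⟨ m+n≤o⇒m≤o∸n (m + m) (m+n≤o⇒m≤o∸n (m + m + z) (subst (_≤ x) (reorder m y z) le)) ⟩
  x ∸ y ∸ z          ≤⟨ m∸n≤m∸[1+n]+1 (x ∸ y) z ⟩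
  x ∸ y ∸ suc z + 1  ∎)
  where
  open ≤-Reasoning
  reorder : ∀ m y z → m + m + y + z ≡ m + m + z + y
  reorder = solve-∀

halve-even : ∀ {m x y} → 2 ∣ x → 2 ∣ y → m + m + y + 1 ≤ x → m ≤ (x ∸ y) / 2 ∸ 1
halve-even {m} (divides a refl) (divides b refl) le = begin
  m                       ≤⟨ m+n≤o⇒m≤o∸n m (subst (_≤ a ∸ b) (+-comm 1 m) (m+n≤o⇒m≤o∸n (suc m) m+b<a)) ⟩
  a ∸ b ∸ 1               ≡⟨ cong (_∸ 1) (m*n/n≡m (a ∸ b) 2) ⟨
  (a ∸ b) * 2 / 2 ∸ 1     ≡⟨ cong (λ t → t / 2 ∸ 1) (*-distribʳ-∸ 2 a b) ⟩
  (a * 2 ∸ b * 2) / 2 ∸ 1 ∎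
  where
  open ≤-Reasoning
  reorder : ∀ m b → m + m + b * 2 + 1 ≡ suc ((m + b) * 2)
  reorder = solve-∀
  m+b<a : m + b < a
  m+b<a = *-cancelʳ-< 2 (m + b) a (subst (_≤ a * 2) (reorder m b) le)

indicator : ∀ {p} {P : Set p} → Dec P → ℕ
indicator (yes _) = 1
indicator (no _)  = 0

indicator-trichotomy : ∀ a b → indicator (a <? b) + indicator (b <? a) + indicator (a ≟ℕ b) ≡ 1
indicator-trichotomy a b with a <? b | b <? a | a ≟ℕ b
... | yes a<b | yes b<a | _        = ⊥-elim (<-asym a<b b<a)
... | yes a<b | no _    | yes refl = ⊥-elim (<-irrefl refl a<b)
... | yes _   | no _    | no _     = refl
... | no _    | yes b<a | yes refl = ⊥-elim (<-irrefl refl b<a)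
... | no _    | yes _   | no _     = refl
... | no _    | no _    | yes _    = refl
... | no a≮b  | no b≮a  | no a≢b   = ⊥-elim (a≢b (≤-antisym (≮⇒≥ b≮a) (≮⇒≥ a≮b)))

sum-replicate-1 : ∀ n → sum {n} (λ _ → 1) ≡ n
sum-replicate-1 zero    = refl
sum-replicate-1 (suc n) = cong suc (sum-replicate-1 n)

sum-onlyAt : ∀ {q} (f : Fin q → ℕ) (x : Fin q) → f x ≡ 1 → (∀ y → y ≢ x → f y ≡ 0) → sum f ≡ 1
sum-onlyAt {suc q} f x fx≡1 f≡0 = begin
  sum f                     ≡⟨ sum-remove {i = x} f ⟩
  f x + sum (removeAt f x)  ≡⟨ cong₂ _+_ fx≡1 (sum-cong-≗ (λ k → f≡0 _ (punchInᵢ≢i x k))) ⟩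
  1 + sum {q} (λ _ → 0)     ≡⟨ cong suc (sum-replicate-zero q) ⟩
  1                         ∎
  where open ≡-Reasoning

module _ {q : ℕ} (ι : Fin q → Fin q) (ι-involutive : ∀ x → ι (ι x) ≡ x) where

  private
    -- below counts each 2-cycle {x, ι x} once, so 2 * sum below + sum fixed ≡ q.
    below fixed : Fin q → ℕ
    below x = indicator (toℕ x <? toℕ (ι x))
    fixed x = indicator (toℕ x ≟ℕ toℕ (ι x))

    orbit-count : ∀ x → below x + below (ι x) + fixed x ≡ 1
    orbit-count x rewrite ι-involutive x = indicator-trichotomy (toℕ x) (toℕ (ι x))

    orbit-sum : sum below + sum (below ∘ ι) + sum fixed ≡ q
    orbit-sum = begin
      sum below + sum (below ∘ ι) + sum fixed        ≡⟨ cong (_+ sum fixed) (∑-distrib-+ below (below ∘ ι)) ⟨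
      sum (λ x → below x + below (ι x)) + sum fixed  ≡⟨ ∑-distrib-+ _ fixed ⟨
      sum (λ x → below x + below (ι x) + fixed x)    ≡⟨ sum-cong-≗ orbit-count ⟩
      sum {q} (λ _ → 1)                              ≡⟨ sum-replicate-1 q ⟩
      q                                              ∎
      where open ≡-Reasoning

    fixedPoints-parity : sum fixed % 2 ≡ q % 2
    fixedPoints-parity = begin
      sum fixed % 2                                  ≡⟨ [m+kn]%n≡m%n (sum fixed) (sum below) 2 ⟨
      (sum fixed + sum below * 2) % 2                ≡⟨ cong (λ t → (sum fixed + t) % 2) (m*2≡m+m (sum below)) ⟩
      (sum fixed + (sum below + sum below)) % 2      ≡⟨ cong (_% 2) (+-comm (sum fixed) _) ⟩
      (sum below + sum below + sum fixed) % 2        ≡⟨ cong (λ t → (sum below + t + sum fixed) % 2) below-ι ⟩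
      (sum below + sum (below ∘ ι) + sum fixed) % 2  ≡⟨ cong (_% 2) orbit-sum ⟩
      q % 2                                          ∎
      where
      open ≡-Reasoning
      below-ι : sum below ≡ sum (below ∘ ι)
      below-ι = sum-permute below (permutation ι ι ι-involutive ι-involutive)

    fixed-≢ : ∀ {x} → ι x ≢ x → fixed x ≡ 0
    fixed-≢ {x} ιx≢x = cong indicator (dec-no _ (λ eq → ιx≢x (sym (toℕ-injective eq))))

  involution-fixedPoint : IsOdd q → ∃ λ x → ι x ≡ x
  involution-fixedPoint q-odd with any? (λ x → ι x ≟ᶠ x)
  ... | yes found = found
  ... | no none   = ⊥-elim (0≢1+n (begin
    0                      ≡⟨ cong (_% 2) (sum-replicate-zero q) ⟨
    sum {q} (λ _ → 0) % 2  ≡⟨ cong (_% 2) (sum-cong-≗ (λ x → fixed-≢ (λ fix → none (x , fix)))) ⟨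
    sum fixed % 2          ≡⟨ fixedPoints-parity ⟩
    q % 2                  ≡⟨ q-odd ⟩
    1                      ∎))
    where open ≡-Reasoning

  involution-anotherFixedPoint : IsEven q → ∀ {x} → ι x ≡ x → ∃ λ y → y ≢ x × ι y ≡ y
  involution-anotherFixedPoint q-even {x} ιx≡x with any? (λ y → ¬? (y ≟ᶠ x) ×-dec (ι y ≟ᶠ y))
  ... | yes found = found
  ... | no none   = ⊥-elim (1+n≢0 (begin
    1              ≡⟨ cong (_% 2) (sum-onlyAt fixed x fixed-x only-x) ⟨
    sum fixed % 2  ≡⟨ fixedPoints-parity ⟩
    q % 2          ≡⟨ q-even ⟩
    0              ∎))
    where
    open ≡-Reasoning
    fixed-x : fixed x ≡ 1
    fixed-x = cong indicator (proj₂ (dec-yes _ (cong toℕ (sym ιx≡x))))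
    only-x : ∀ y → y ≢ x → fixed y ≡ 0
    only-x y y≢x = fixed-≢ (λ fix → none (y , y≢x , fix))

funToFin-cong : ∀ {L q} {u v : Fin L → Fin q} → u ≗ v → funToFin u ≡ funToFin v
funToFin-cong {zero}  _   = refl
funToFin-cong {suc L} u≗v = cong₂ combine (u≗v zero) (funToFin-cong (u≗v ∘ suc))

funToFin-injective : ∀ {L q} {u v : Fin L → Fin q} → funToFin u ≡ funToFin v → u ≗ v
funToFin-injective {u = u} {v} eq k =
  trans (sym (finToFun-funToFin u k)) (trans (cong (λ i → finToFun i k) eq) (finToFun-funToFin v k))

finToFun-injective : ∀ {L q} {i j : Fin (q ^ L)} → finToFun {q} {L} i ≗ finToFun j → i ≡ j
finToFun-injective {L} {q} {i} {j} eq =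
  trans (sym (funToFin-finToFin {L} {q} i)) (trans (funToFin-cong eq) (funToFin-finToFin {L} {q} j))

distinctTuples⇒≤ : ∀ {a L q} (f : Vector (Fin L → Fin q) a) → Injective _≡_ _≗_ f → a ≤ q ^ L
distinctTuples⇒≤ f f-injective = injective⇒≤ (f-injective ∘ funToFin-injective)

++-injective : ∀ {a ℓ} {A : Set a} {_≈_ : Rel A ℓ} → Symmetric _≈_ →
               ∀ {m n} {f : Vector A m} {g : Vector A n} →
               Injective _≡_ _≈_ f → Injective _≡_ _≈_ g → (∀ i j → ¬ f i ≈ g j) →
               Injective _≡_ _≈_ (f ++ g)
++-injective {_≈_ = _≈_} ≈-sym {m} {n} {f} {g} f-injective g-injective f≉g {x} {y} eq = begin
  x                       ≡⟨ join-splitAt m n x ⟨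
  join m n (splitAt m x)  ≡⟨ cong (join m n) ([f,g]-injective (splitAt m x) (splitAt m y) eq) ⟩
  join m n (splitAt m y)  ≡⟨ join-splitAt m n y ⟩
  y                       ∎
  where
  open ≡-Reasoning
  [f,g]-injective : ∀ x′ y′ → [ f , g ] x′ ≈ [ f , g ] y′ → x′ ≡ y′
  [f,g]-injective (inj₁ i) (inj₁ j) e = cong inj₁ (f-injective e)
  [f,g]-injective (inj₁ i) (inj₂ j) e = ⊥-elim (f≉g i j e)
  [f,g]-injective (inj₂ i) (inj₁ j) e = ⊥-elim (f≉g j i (≈-sym e))
  [f,g]-injective (inj₂ i) (inj₂ j) e = cong inj₂ (g-injective e)

-- punchIn for sizes such as q ^ k that are not syntactically successors
punchIn′ : ∀ {P} → Fin P → Fin (P ∸ 1) → Fin P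
punchIn′ {suc P} = punchIn

punchIn′-injective : ∀ {P} (z : Fin P) {i j : Fin (P ∸ 1)} → punchIn′ z i ≡ punchIn′ z j → i ≡ j
punchIn′-injective {suc P} z = punchIn-injective z _ _

punchIn′ᵢ≢i : ∀ {P} (z : Fin P) (i : Fin (P ∸ 1)) → punchIn′ z i ≢ z
punchIn′ᵢ≢i {suc P} = punchInᵢ≢i

shift-invariant⇒constant : ∀ {a} {A : Set a} {ℓ} (u : Vector A (suc ℓ)) →
                           (∀ k → u (suc k) ≡ u (inject₁ k)) → ∀ k → u k ≡ head u
shift-invariant⇒constant u step zero = refl
shift-invariant⇒constant {ℓ = suc ℓ} u step (suc k) =
  trans (step k) (shift-invariant⇒constant (init u) (step ∘ inject₁) k)

opposite-inject₁ : ∀ {ℓ} (k : Fin ℓ) → opposite (inject₁ k) ≡ suc (opposite k)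
opposite-inject₁ {ℓ} k = toℕ-injective (begin
  toℕ (opposite (inject₁ k))    ≡⟨ opposite-prop (inject₁ k) ⟩
  suc ℓ ∸ suc (toℕ (inject₁ k)) ≡⟨ cong (ℓ ∸_) (toℕ-inject₁ k) ⟩
  ℓ ∸ toℕ k                     ≡⟨ +-∸-assoc 1 (toℕ<n k) ⟩
  suc (ℓ ∸ suc (toℕ k))         ≡⟨ cong suc (opposite-prop k) ⟨
  suc (toℕ (opposite k))        ∎)
  where open ≡-Reasoning

module _ {q₀ : ℕ} where
  private
    q = suc q₀
    F = Fin q
    module TupleSetoid {L : ℕ} = Setoid (Fin L →-setoid F)
    open TupleSetoid using () renaming (sym to ≗-sym; trans to ≗-trans)

  toℕ-negZ : (x : F) → toℕ (negZ x) ≡ (q ∸ toℕ x) % q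
  toℕ-negZ x = toℕ-fromℕ< _

  toℕ-negZ-suc : (y : Fin q₀) → toℕ (negZ {q} (suc y)) ≡ q ∸ suc (toℕ y)
  toℕ-negZ-suc y = trans (toℕ-negZ (suc y)) (m<n⇒m%n≡m (s≤s (m∸n≤m q₀ (toℕ y))))

  negZ-zero : negZ {q} zero ≡ zero
  negZ-zero = toℕ-injective (trans (toℕ-negZ zero) (n%n≡0 q))

  negZ-involutive : (x : F) → negZ (negZ x) ≡ x
  negZ-involutive zero    = trans (cong negZ negZ-zero) negZ-zero
  negZ-involutive (suc y) = toℕ-injective (begin
    toℕ (negZ (negZ (suc y)))    ≡⟨ toℕ-negZ (negZ (suc y)) ⟩
    (q ∸ toℕ (negZ (suc y))) % q ≡⟨ cong (λ t → (q ∸ t) % q) (toℕ-negZ-suc y) ⟩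
    (q ∸ (q ∸ suc (toℕ y))) % q  ≡⟨ cong (_% q) (m∸[m∸n]≡n (<⇒≤ (toℕ<n (suc y)))) ⟩
    suc (toℕ y) % q              ≡⟨ m<n⇒m%n≡m (toℕ<n (suc y)) ⟩
    suc (toℕ y)                  ∎)
    where open ≡-Reasoning

  negZ-fixed⇒zero : IsOdd q → (x : F) → negZ x ≡ x → x ≡ zero
  negZ-fixed⇒zero q-odd zero    _  = refl
  negZ-fixed⇒zero q-odd (suc y) eq = ⊥-elim (0≢1+n (begin
    0                                    ≡⟨ m*n%n≡0 (suc (toℕ y)) 2 ⟨
    suc (toℕ y) * 2 % 2                  ≡⟨ cong (_% 2) (m*2≡m+m (suc (toℕ y))) ⟩
    (suc (toℕ y) + suc (toℕ y)) % 2      ≡⟨ cong (λ t → (suc (toℕ y) + t) % 2) (trans (cong toℕ (sym eq))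
                                                                                   (toℕ-negZ-suc y)) ⟩
    (suc (toℕ y) + (q ∸ suc (toℕ y))) % 2 ≡⟨ cong (_% 2) (m+[n∸m]≡n (<⇒≤ (toℕ<n (suc y)))) ⟩
    q % 2                                ≡⟨ q-odd ⟩
    1                                    ∎))
    where open ≡-Reasoning

  module _ (q-even : IsEven q) where
    private
      half<q : q / 2 < q
      half<q = m/n<m q 2 (s≤s (s≤s z≤n))

    half : F
    half = fromℕ< half<q

    negZ-half : negZ half ≡ half
    negZ-half = toℕ-injective (begin
      toℕ (negZ half)             ≡⟨ toℕ-negZ half ⟩
      (q ∸ toℕ half) % q          ≡⟨ cong (λ t → (q ∸ t) % q) (toℕ-fromℕ< half<q) ⟩
      (q ∸ q / 2) % q             ≡⟨ cong (λ t → (t ∸ q / 2) % q) (even⇒≡m/2+m/2 {q} q-even) ⟩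
      (q / 2 + q / 2 ∸ q / 2) % q ≡⟨ cong (_% q) (m+n∸n≡m (q / 2) (q / 2)) ⟩
      q / 2 % q                   ≡⟨ m<n⇒m%n≡m half<q ⟩
      q / 2                       ≡⟨ toℕ-fromℕ< half<q ⟨
      toℕ half                    ∎)
      where open ≡-Reasoning

    half≢zero : half ≢ zero
    half≢zero half≡0 = 1+n≢0 (trans (even⇒≡m/2+m/2 {q} q-even)
      (cong (λ t → t + t) (trans (sym (toℕ-fromℕ< half<q)) (cong toℕ half≡0))))

  Tuple : ℕ → Set
  Tuple L = Fin L → F

  negRev : ∀ {L} → Tuple L → Tuple L
  negRev u = rev (negT u)

  NegPalindrome : ∀ {L} → Tuple L → Set
  NegPalindrome u = negRev u ≗ u

  negRev-cong : ∀ {L} {u v : Tuple L} → u ≗ v → negRev u ≗ negRev v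
  negRev-cong u≗v k = cong negZ (u≗v (opposite k))

  negRev-involutive : ∀ {L} (u : Tuple L) → negRev (negRev u) ≗ u
  negRev-involutive u k = trans (negZ-involutive _) (cong u (opposite-involutive k))

  negRev-injective : ∀ {L} {u v : Tuple L} → negRev u ≗ negRev v → u ≗ v
  negRev-injective {u = u} {v} eq k =
    trans (sym (negRev-involutive u k)) (trans (negRev-cong eq k) (negRev-involutive v k))

  negRev-∷ : ∀ {L} (u : Tuple (suc L)) → negRev u ≗ negZ (last u) ∷ negRev (init u)
  negRev-∷ u zero    = refl
  negRev-∷ u (suc k) = refl

  negPalindrome-∷⇒constant : ∀ {L x} {v : Tuple L} → NegPalindrome v → NegPalindrome (x ∷ v) →
                             ∀ k → (x ∷ v) k ≡ x
  negPalindrome-∷⇒constant {x = x} {v} v-pal xv-pal = shift-invariant⇒constant (x ∷ v) step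
    where
    open ≡-Reasoning
    step : ∀ k → v k ≡ (x ∷ v) (inject₁ k)
    step k = begin
      v k                                   ≡⟨ v-pal k ⟨
      negZ ((x ∷ v) (suc (opposite k)))     ≡⟨ cong (negZ ∘ (x ∷ v)) (opposite-inject₁ k) ⟨
      negZ ((x ∷ v) (opposite (inject₁ k))) ≡⟨ xv-pal (inject₁ k) ⟩
      (x ∷ v) (inject₁ k)                   ∎

  negPalindrome-∷⇒zero : IsOdd q → ∀ {L x} {v : Tuple L} → NegPalindrome v → NegPalindrome (x ∷ v) →
                         v ≗ (λ _ → zero)
  negPalindrome-∷⇒zero q-odd {x = x} v-pal xv-pal k = trans (constant (suc k)) x≡0
    where
    constant = negPalindrome-∷⇒constant v-pal xv-pal
    x≡0 : x ≡ zero
    x≡0 = negZ-fixed⇒zero q-odd x (trans (cong negZ (sym (constant (opposite zero)))) (xv-pal zero))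

  ∷zeros-negPalindrome⇒zero : ∀ {L x} → 1 ≤ L → NegPalindrome (x ∷ (λ (_ : Fin L) → zero)) → x ≡ zero
  ∷zeros-negPalindrome⇒zero {suc L} _ pal = trans (sym (pal zero)) negZ-zero

  module _ {L : ℕ} where

    mirror : F → Tuple L → Tuple L
    mirror c u k with <-cmp (toℕ k) (toℕ (opposite k))
    ... | tri< _ _ _ = u k
    ... | tri≈ _ _ _ = c
    ... | tri> _ _ _ = negZ (u (opposite k))

    mirror-< : ∀ {c u k} → toℕ k < toℕ (opposite k) → mirror c u k ≡ u k
    mirror-< {k = k} lt with <-cmp (toℕ k) (toℕ (opposite k))
    ... | tri< _ _ _   = refl
    ... | tri≈ ¬lt _ _ = ⊥-elim (¬lt lt)
    ... | tri> ¬lt _ _ = ⊥-elim (¬lt lt)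

    mirror-≡ : ∀ {c u k} → toℕ k ≡ toℕ (opposite k) → mirror c u k ≡ c
    mirror-≡ {k = k} eq with <-cmp (toℕ k) (toℕ (opposite k))
    ... | tri< _ ¬eq _ = ⊥-elim (¬eq eq)
    ... | tri≈ _ _ _   = refl
    ... | tri> _ ¬eq _ = ⊥-elim (¬eq eq)

    mirror-> : ∀ {c u k} → toℕ (opposite k) < toℕ k → mirror c u k ≡ negZ (u (opposite k))
    mirror-> {k = k} gt with <-cmp (toℕ k) (toℕ (opposite k))
    ... | tri< _ _ ¬gt = ⊥-elim (¬gt gt)
    ... | tri≈ _ _ ¬gt = ⊥-elim (¬gt gt)
    ... | tri> _ _ _   = refl

    mirror-negPalindrome : ∀ {c} u → negZ c ≡ c → NegPalindrome (mirror c u)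
    mirror-negPalindrome {c} u c-fixed k = by-position (<-cmp (toℕ k) (toℕ (opposite k)))
      where
      k≡opp-opp : toℕ k ≡ toℕ (opposite (opposite k))
      k≡opp-opp = sym (cong toℕ (opposite-involutive k))

      by-position : Tri (toℕ k < toℕ (opposite k)) (toℕ k ≡ toℕ (opposite k)) (toℕ (opposite k) < toℕ k) →
                    negZ (mirror c u (opposite k)) ≡ mirror c u k
      by-position (tri< lt _ _) = begin
        negZ (mirror c u (opposite k))
          ≡⟨ cong negZ (mirror-> (subst (_< toℕ (opposite k)) k≡opp-opp lt)) ⟩
        negZ (negZ (u (opposite (opposite k)))) ≡⟨ negZ-involutive _ ⟩
        u (opposite (opposite k))               ≡⟨ cong u (opposite-involutive k) ⟩
        u k                                     ≡⟨ mirror-< lt ⟨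
        mirror c u k                            ∎
        where open ≡-Reasoning
      by-position (tri≈ _ eq _) =
        trans (cong negZ (mirror-≡ (trans (sym eq) k≡opp-opp))) (trans c-fixed (sym (mirror-≡ eq)))
      by-position (tri> _ _ gt) =
        trans (cong negZ (mirror-< (subst (toℕ (opposite k) <_) k≡opp-opp gt))) (sym (mirror-> gt))

    pad : (Fin (L / 2) → F) → Tuple L
    pad H k with toℕ k <? L / 2
    ... | yes k<h = H (fromℕ< k<h)
    ... | no _    = zero

    lowIndex : Fin (L / 2) → Fin L
    lowIndex a = inject≤ a (m/n≤m L 2)

    lowIndex-< : ∀ a → toℕ (lowIndex a) < toℕ (opposite (lowIndex a))
    lowIndex-< a rewrite opposite-prop (lowIndex a) | toℕ-inject≤ a (m/n≤m L 2) =
      m+n≤o⇒m≤o∸n (suc (toℕ a)) (≤-trans (+-mono-≤ (toℕ<n a) (toℕ<n a)) (m/2+m/2≤m L))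

    pad-lowIndex : ∀ H a → pad H (lowIndex a) ≡ H a
    pad-lowIndex H a with toℕ (lowIndex a) <? L / 2
    ... | yes k<h = cong H (toℕ-injective (trans (toℕ-fromℕ< k<h) (toℕ-inject≤ a (m/n≤m L 2))))
    ... | no k≮h  = ⊥-elim (k≮h (subst (_< L / 2) (sym (toℕ-inject≤ a (m/n≤m L 2))) (toℕ<n a)))

    negPalindromes : F → Vector (Tuple L) (q ^ (L / 2))
    negPalindromes c i = mirror c (pad (finToFun i))

    negPalindromes-negPalindrome : ∀ {c} → negZ c ≡ c → ∀ i → NegPalindrome (negPalindromes c i)
    negPalindromes-negPalindrome c-fixed i = mirror-negPalindrome (pad (finToFun i)) c-fixed

    negPalindromes-lowIndex : ∀ c i a → negPalindromes c i (lowIndex a) ≡ finToFun i a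
    negPalindromes-lowIndex c i a = trans (mirror-< (lowIndex-< a)) (pad-lowIndex (finToFun i) a)

    negPalindromes-injective : ∀ c → Injective _≡_ _≗_ (negPalindromes c)
    negPalindromes-injective c {i} {j} eq = finToFun-injective λ a →
      trans (sym (negPalindromes-lowIndex c i a)) (trans (eq (lowIndex a)) (negPalindromes-lowIndex c j a))

    negPalindromes-zero : ∀ {c i} → negPalindromes c i ≗ (λ _ → zero) →
                          i ≡ funToFin (λ (_ : Fin (L / 2)) → zero)
    negPalindromes-zero {c} {i} eq = trans (sym (funToFin-finToFin {L / 2} {q} i))
      (funToFin-cong (λ a → trans (sym (negPalindromes-lowIndex c i a)) (eq (lowIndex a))))

    negPalindromes-middle : IsOdd L → ∀ {c c′ i j} → negPalindromes c i ≗ negPalindromes c′ j → c ≡ c′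
    negPalindromes-middle L-odd eq =
      trans (sym (mirror-≡ middle-fixed)) (trans (eq middle) (mirror-≡ middle-fixed))
      where
      L≡ : L ≡ suc (L / 2 + L / 2)
      L≡ = odd⇒≡1+m/2+m/2 {L} L-odd
      middle : Fin L
      middle = fromℕ< (subst (L / 2 <_) (sym L≡) (s≤s (m≤m+n _ _)))
      middle-fixed : toℕ middle ≡ toℕ (opposite middle)
      middle-fixed = begin
        toℕ middle                ≡⟨ toℕ-fromℕ< _ ⟩
        L / 2                     ≡⟨ m+n∸m≡n (L / 2) (L / 2) ⟨
        L / 2 + L / 2 ∸ L / 2     ≡⟨ cong (λ t → t ∸ suc (L / 2)) L≡ ⟨
        L ∸ suc (L / 2)           ≡⟨ cong (λ t → L ∸ suc t) (toℕ-fromℕ< _) ⟨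
        L ∸ suc (toℕ middle)      ≡⟨ opposite-prop middle ⟨
        toℕ (opposite middle)     ∎
        where open ≡-Reasoning

  module NegativeOrientable {m₀ ℓ : ℕ} (s : Fin (suc m₀) → F) (nos : IsNOS (suc ℓ) s) where
    private
      m = suc m₀
      n = suc ℓ

    -- Positions are natural numbers read modulo m, so m₀ + p is the position before p.
    windowAt : ℕ → Tuple n
    windowAt p k = entry s (p + toℕ k)

    position : ℕ → Fin m
    position p = fromℕ< (m%n<n p m)

    windowAt-mod : ∀ {a b} → a % m ≡ b % m → windowAt a ≗ windowAt b
    windowAt-mod {a} {b} eq k = cong s (fromℕ<-cong _ _ (%-cong-+ʳ {a} {b} (toℕ k) m eq) _ _)

    window-position : ∀ p → window n s (position p) ≗ windowAt p
    window-position p = windowAt-mod {toℕ (position p)} {p}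
      (trans (cong (_% m) (toℕ-fromℕ< (m%n<n p m))) (m%n%n≡m%n p m))

    windowAt-injective : ∀ {a b} → windowAt a ≗ windowAt b → a % m ≡ b % m
    windowAt-injective {a} {b} eq = begin
      a % m             ≡⟨ toℕ-fromℕ< (m%n<n a m) ⟨
      toℕ (position a)  ≡⟨ cong toℕ (proj₁ nos _ _ (≗-trans (window-position a)
                                                     (≗-trans eq (≗-sym (window-position b))))) ⟩
      toℕ (position b)  ≡⟨ toℕ-fromℕ< (m%n<n b m) ⟩
      b % m             ∎
      where open ≡-Reasoning

    windowAt≉negRev : ∀ a b → ¬ windowAt a ≗ negRev (windowAt b)
    windowAt≉negRev a b eq = proj₂ nos (position a) (position b)
      (≗-trans (window-position a) (≗-trans eq (negRev-cong (≗-sym (window-position b)))))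

    windowAt-shift : ∀ c {a b} → windowAt a ≗ windowAt b → windowAt (c + a) ≗ windowAt (c + b)
    windowAt-shift c {a} {b} eq =
      windowAt-mod {c + a} {c + b} (%-cong-+ˡ {a} {b} c m (windowAt-injective {a} {b} eq))

    windowAt-period : ∀ p → windowAt (m + p) ≗ windowAt p
    windowAt-period p = windowAt-mod {m + p} {p} (%-remove-+ˡ {m} p ∣-refl)

    windowAt-period′ : ∀ p → windowAt (m₀ + suc p) ≗ windowAt p
    windowAt-period′ p k = trans (cong (λ t → windowAt t k) (+-suc m₀ p)) (windowAt-period p k)

    windowAt-tail : ∀ p → tail (windowAt p) ≗ init (windowAt (suc p))
    windowAt-tail p k =
      cong (entry s) (trans (+-suc p (toℕ k)) (cong (λ t → suc (p + t)) (sym (toℕ-inject₁ k))))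

    IsWindow IsNegRevWindow Unused : Tuple n → Set
    IsWindow u = ∃ λ i → window n s i ≗ u
    IsNegRevWindow u = ∃ λ i → negRev (window n s i) ≗ u
    Unused u = ¬ IsWindow u × ¬ IsNegRevWindow u

    negPalindrome⇒unused : ∀ {u} → NegPalindrome u → Unused u
    negPalindrome⇒unused {u} u-pal =
      (λ (i , eq) → proj₂ nos i i (≗-trans eq (≗-trans (≗-sym u-pal) (negRev-cong (≗-sym eq))))) ,
      (λ (i , eq) → proj₂ nos i i (≗-trans (negRev-injective (≗-trans eq (≗-sym u-pal))) (≗-sym eq)))

    module Partner (v : Tuple ℓ) (v-pal : NegPalindrome v) where

      next-window : ∀ {p x} → windowAt p ≗ x ∷ v →
                    negZ (last (windowAt (suc p))) ∷ v ≗ negRev (windowAt (suc p))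
      next-window {p} eq = ≗-trans (∷-cong refl tail≗) (≗-sym (negRev-∷ (windowAt (suc p))))
        where
        tail≗ : v ≗ negRev (init (windowAt (suc p)))
        tail≗ = ≗-trans (≗-sym v-pal) (negRev-cong (≗-trans (≗-sym (eq ∘ suc)) (windowAt-tail p)))

      previous-window : ∀ {p x} → negRev (windowAt p) ≗ x ∷ v →
                        head (windowAt (m₀ + p)) ∷ v ≗ windowAt (m₀ + p)
      previous-window {p} eq = ∷-cong refl (≗-sym tail≗)
        where
        init≗ : init (windowAt p) ≗ v
        init≗ = negRev-injective
          (≗-trans (proj₂ (∷-injective (≗-trans (≗-sym (negRev-∷ (windowAt p))) eq))) (≗-sym v-pal))
        tail≗ : tail (windowAt (m₀ + p)) ≗ v
        tail≗ = ≗-trans (windowAt-tail (m₀ + p)) (≗-trans (λ k → windowAt-period p (inject₁ k)) init≗)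

      isWindow? : ∀ u → Dec (IsWindow u)
      isWindow? u = any? (λ i → ≗-dec _≟ᶠ_ (window n s i) u)

      isNegRevWindow? : ∀ u → Dec (IsNegRevWindow u)
      isNegRevWindow? u = any? (λ i → ≗-dec _≟ᶠ_ (negRev (window n s i)) u)

      partnerOf : ∀ x → Dec (IsWindow (x ∷ v)) → Dec (IsNegRevWindow (x ∷ v)) → F
      partnerOf x (yes (i , _)) _            = negZ (last (windowAt (suc (toℕ i))))
      partnerOf x (no _)        (yes (i , _)) = head (windowAt (m₀ + toℕ i))
      partnerOf x (no _)        (no _)        = x

      partner : F → F
      partner x = partnerOf x (isWindow? (x ∷ v)) (isNegRevWindow? (x ∷ v))

      partner-window : ∀ {p x} → windowAt p ≗ x ∷ v → partner x ∷ v ≗ negRev (windowAt (suc p))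
      partner-window {p} {x} eq with isWindow? (x ∷ v)
      ... | yes (i , eqᵢ) = ≗-trans (next-window eqᵢ) (negRev-cong (windowAt-shift 1 (≗-trans eqᵢ (≗-sym eq))))
      ... | no ¬window    = ⊥-elim (¬window (position p , ≗-trans (window-position p) eq))

      partner-negRevWindow : ∀ {p x} → negRev (windowAt p) ≗ x ∷ v → partner x ∷ v ≗ windowAt (m₀ + p)
      partner-negRevWindow {p} {x} eq with isWindow? (x ∷ v)
      ... | yes (i , eqᵢ) = ⊥-elim (windowAt≉negRev (toℕ i) p (≗-trans eqᵢ (≗-sym eq)))
      ... | no _ with isNegRevWindow? (x ∷ v)
      ...   | yes (i , eqᵢ) =
        ≗-trans (previous-window eqᵢ) (windowAt-shift m₀ (negRev-injective (≗-trans eqᵢ (≗-sym eq))))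
      ...   | no ¬negRevWindow =
        ⊥-elim (¬negRevWindow (position p , ≗-trans (negRev-cong (window-position p)) eq))

      partner-unused : ∀ {x} → Unused (x ∷ v) → partner x ≡ x
      partner-unused {x} (¬window , ¬negRevWindow) with isWindow? (x ∷ v) | isNegRevWindow? (x ∷ v)
      ... | yes window | _               = ⊥-elim (¬window window)
      ... | no _       | yes negRevWindow = ⊥-elim (¬negRevWindow negRevWindow)
      ... | no _       | no _            = refl

      partner-involutive : ∀ x → partner (partner x) ≡ x
      partner-involutive x = by-cases (isWindow? (x ∷ v)) (isNegRevWindow? (x ∷ v))
        where
        by-cases : Dec (IsWindow (x ∷ v)) → Dec (IsNegRevWindow (x ∷ v)) → partner (partner x) ≡ x
        by-cases (yes (i , eq)) _ =
          ≗-trans (partner-negRevWindow (≗-sym (partner-window eq)))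
                  (≗-trans (windowAt-period′ (toℕ i)) eq) zero
        by-cases (no _) (yes (i , eq)) =
          ≗-trans (partner-window (≗-sym (partner-negRevWindow eq)))
                  (≗-trans (negRev-cong (windowAt-period (toℕ i))) eq) zero
        by-cases (no ¬window) (no ¬negRevWindow) =
          trans (cong partner fixed) fixed
          where fixed = partner-unused (¬window , ¬negRevWindow)

      partner-fixed⇒unused : ∀ {x} → partner x ≡ x → Unused (x ∷ v)
      partner-fixed⇒unused {x} fixed =
        (λ (i , eq) → windowAt≉negRev (toℕ i) (suc (toℕ i))
                        (≗-trans eq (≗-trans (≗-sym fixed′) (partner-window eq)))) ,
        (λ (i , eq) → windowAt≉negRev (m₀ + toℕ i) (toℕ i)
                        (≗-trans (≗-sym (partner-negRevWindow eq)) (≗-trans fixed′ (≗-sym eq))))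
        where
        fixed′ : partner x ∷ v ≗ x ∷ v
        fixed′ = cong-app (cong (_∷ v) fixed)

    occurrences : Vector (Tuple n) (m + m)
    occurrences = window n s ++ (negRev ∘ window n s)

    occurrences-injective : Injective _≡_ _≗_ occurrences
    occurrences-injective =
      ++-injective {_≈_ = _≗_} ≗-sym
        (λ {i} {j} → proj₁ nos i j) (λ {i} {j} eq → proj₁ nos i j (negRev-injective eq)) (proj₂ nos)

    unused⇒∉occurrences : ∀ {u} → Unused u → ∀ i → ¬ occurrences i ≗ u
    unused⇒∉occurrences {u} (¬window , ¬negRevWindow) =
      ++⁺ (λ t → ¬ t ≗ u)
        (λ i eq → ¬window (i , eq)) (λ i eq → ¬negRevWindow (i , eq))

    period-bound : ∀ {N K} (palindromes : Vector (Tuple n) N) (extras : Vector (Tuple n) K) →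
                   Injective _≡_ _≗_ palindromes → (∀ i → NegPalindrome (palindromes i)) →
                   Injective _≡_ _≗_ extras → (∀ j → Unused (extras j)) → (∀ j → ¬ NegPalindrome (extras j)) →
                   m + m + N + K ≤ q ^ n
    period-bound palindromes extras pal-injective pal extras-injective extras-unused extras-¬pal =
      distinctTuples⇒≤ ((occurrences ++ palindromes) ++ extras)
        (++-injective {_≈_ = _≗_} ≗-sym
          (++-injective {_≈_ = _≗_} ≗-sym occurrences-injective pal-injective
            (λ i j → unused⇒∉occurrences (negPalindrome⇒unused (pal j)) i))
          extras-injective
          (λ i j → ++⁺ (λ t → ¬ t ≗ extras j) (unused⇒∉occurrences (extras-unused j))
            (λ i eq → extras-¬pal j (≗-trans (negRev-cong (≗-sym eq)) (≗-trans (pal i) eq))) i))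

    period-bound-odd : IsOdd q → m + m + q ^ (n / 2) + (q ^ (ℓ / 2) ∸ 1) ≤ q ^ n
    period-bound-odd q-odd =
      period-bound (negPalindromes zero) extras
        (negPalindromes-injective zero) (negPalindromes-negPalindrome negZ-zero)
        extras-injective extras-unused extras-¬pal
      where
      -- The zero vertex is skipped: its fixed point may be 0, and 0 ∷ 0 is a negative palindrome.
      zeroIndex : Fin (q ^ (ℓ / 2))
      zeroIndex = funToFin (λ (_ : Fin (ℓ / 2)) → zero)

      vertex : Vector (Tuple ℓ) (q ^ (ℓ / 2) ∸ 1)
      vertex j = negPalindromes zero (punchIn′ zeroIndex j)

      vertex-pal : ∀ j → NegPalindrome (vertex j)
      vertex-pal j = negPalindromes-negPalindrome negZ-zero _

      fixedPoint : ∀ j → ∃ λ x → Partner.partner (vertex j) (vertex-pal j) x ≡ x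
      fixedPoint j = involution-fixedPoint partner partner-involutive q-odd
        where open Partner (vertex j) (vertex-pal j)

      extras : Vector (Tuple n) (q ^ (ℓ / 2) ∸ 1)
      extras j = proj₁ (fixedPoint j) ∷ vertex j

      extras-injective : Injective _≡_ _≗_ extras
      extras-injective eq = punchIn′-injective zeroIndex (negPalindromes-injective zero (eq ∘ suc))

      extras-unused : ∀ j → Unused (extras j)
      extras-unused j = Partner.partner-fixed⇒unused (vertex j) (vertex-pal j) (proj₂ (fixedPoint j))

      extras-¬pal : ∀ j → ¬ NegPalindrome (extras j)
      extras-¬pal j pal =
        punchIn′ᵢ≢i zeroIndex j (negPalindromes-zero (negPalindrome-∷⇒zero q-odd (vertex-pal j) pal))

    module _ (q-even : IsEven q) (1≤ℓ : 1 ≤ ℓ) where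
      private
        zeros : Tuple ℓ
        zeros _ = zero

        open Partner zeros (λ _ → negZ-zero)

        zero∷zeros-pal : NegPalindrome (zero ∷ zeros)
        zero∷zeros-pal k = trans (cong negZ (zero∷zeros (opposite k))) (trans negZ-zero (sym (zero∷zeros k)))
          where
          zero∷zeros : ∀ k → (zero ∷ zeros) k ≡ zero
          zero∷zeros zero    = refl
          zero∷zeros (suc _) = refl

        nonzeroFixedPoint : ∃ λ y → y ≢ zero × partner y ≡ y
        nonzeroFixedPoint = involution-anotherFixedPoint partner partner-involutive q-even
          (partner-unused (negPalindrome⇒unused zero∷zeros-pal))

        period-bound-even-with : ∀ {N} (palindromes : Vector (Tuple n) N) →
                                 Injective _≡_ _≗_ palindromes → (∀ i → NegPalindrome (palindromes i)) →
                                 m + m + N + 1 ≤ q ^ n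
        period-bound-even-with palindromes pal-injective pal =
          period-bound palindromes (λ _ → proj₁ nonzeroFixedPoint ∷ zeros) pal-injective pal
            (λ { {zero} {zero} _ → refl })
            (λ _ → partner-fixed⇒unused (proj₂ (proj₂ nonzeroFixedPoint)))
            (λ _ pal′ → proj₁ (proj₂ nonzeroFixedPoint) (∷zeros-negPalindrome⇒zero 1≤ℓ pal′))

      period-bound-even : m + m + q ^ (n / 2) + 1 ≤ q ^ n
      period-bound-even =
        period-bound-even-with (negPalindromes {n} zero)
          (negPalindromes-injective zero) (negPalindromes-negPalindrome negZ-zero)

      period-bound-even-oddLength : IsOdd n → m + m + 2 * q ^ (ℓ / 2) + 1 ≤ q ^ n
      period-bound-even-oddLength n-odd =
        subst (λ N → m + m + N + 1 ≤ q ^ n) N≡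
          (period-bound-even-with palindromes palindromes-injective palindromes-pal)
        where
        palindromes : Vector (Tuple n) (q ^ (n / 2) + q ^ (n / 2))
        palindromes = negPalindromes zero ++ negPalindromes (half q-even)

        palindromes-injective : Injective _≡_ _≗_ palindromes
        palindromes-injective =
          ++-injective {_≈_ = _≗_} ≗-sym
            (negPalindromes-injective zero) (negPalindromes-injective (half q-even))
            (λ i j eq → half≢zero q-even (sym (negPalindromes-middle n-odd {zero} {half q-even} {i} {j} eq)))

        palindromes-pal : ∀ i → NegPalindrome (palindromes i)
        palindromes-pal = ++⁺ NegPalindrome
          (negPalindromes-negPalindrome negZ-zero) (negPalindromes-negPalindrome (negZ-half q-even))

        N≡ : q ^ (n / 2) + q ^ (n / 2) ≡ 2 * q ^ (ℓ / 2)
        N≡ = trans (cong (λ h → q ^ h + q ^ h) (sym (odd⇒[m∸1]/2≡m/2 {n} n-odd)))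
                   (cong (q ^ (ℓ / 2) +_) (sym (+-identityʳ _)))

theorem1 : (q n m : ℕ) → 2 ≤ q → 2 ≤ n → .{{_ : NonZero q}} → .{{_ : NonZero m}} →
    (s : Fin m → Fin q) → IsNOS n s →
    (IsOdd q → m ≤ (q ^ n ∸ q ^ (n / 2) ∸ q ^ ((n ∸ 1) / 2) + 1) / 2) ×
    (IsEven q → IsOdd n → m ≤ (q ^ n ∸ 2 * q ^ ((n ∸ 1) / 2)) / 2 ∸ 1) ×
    (IsEven q → IsEven n → m ≤ (q ^ n ∸ q ^ (n / 2)) / 2 ∸ 1)
theorem1 q n zero _ _ _ _ = (λ _ → z≤n) , (λ _ _ → z≤n) , (λ _ _ → z≤n)
theorem1 q@(suc _) n@(suc ℓ) (suc _) _ (s≤s 1≤ℓ) s nos =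
    (λ q-odd → halve-odd (m^n>0 q (ℓ / 2)) (period-bound-odd q-odd))
  , (λ q-even n-odd →
       halve-even (even⇒2∣^ {q} {n} q-even (s≤s z≤n)) (m∣m*n (q ^ (ℓ / 2)))
         (period-bound-even-oddLength q-even 1≤ℓ n-odd))
  , (λ q-even _ →
       halve-even (even⇒2∣^ {q} {n} q-even (s≤s z≤n)) (even⇒2∣^ {q} {n / 2} q-even (/-monoˡ-≤ 2 (s≤s 1≤ℓ)))
         (period-bound-even q-even 1≤ℓ))
  where open NegativeOrientable s nos
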